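{- (Computational adequacy) Let $t$ be a PCF term of type $\iota$. Then \[\prod_{p:\mathrm{isdefined}([\![t]\!])} t\leadsto^*\underline{\mathrm{value}([\![t]\!])(p)}.\] Equivalently, for every $n:\mathbb N$, if $[\![t]\!]=[\![\underline n]\!]$ then $t\leadsto^*\underline n$.
   Context: Ambient theory: intensional Martin-Löf type theory with function extensionality, propositional extensionality and propositional truncation $\|-\|$. There are universes $\mathcal U_0:\mathcal U_1$ with $\mathbb N:\mathcal U_0$, and $\Omega$ is the type of propositions in $\mathcal U_0$. PCF types are $\iota$ and $\sigma\Rightarrow\tau$. PCF terms are generated inductively by the following constants and application: - $\mathsf{zero}:\iota$; - $\mathsf{succ},\mathsf{pred}:\iota\Rightarrow\iota$; - $\mathsf{ifz}:\iota\Rightarrow\iota\Rightarrow\iota\Rightarrow\iota$; - $\mathsf k_{\sigma,\tau}:\sigma\Rightarrow\tau\Rightarrow\sigma$; - $\mathsf s_{\sigma,\tau,\rho}:(\sigma\Rightarrow\tau\Rightarrow\rho)\Rightarrow(\sigma\Rightarrow\tau)\Rightarrow\sigma\Rightarrow\rho$; - $\mathsf{fix}_\sigma:(\sigma\Rightarrow\sigma)\Rightarrow\sigma$; - application $st:\tau$ for $s:\sigma\Rightarrow\tau$ and $t:\sigma$ (left associative). Numerals: $\underline 0:=\mathsf{zero}$ and $\underline{n+1}:=\mathsf{succ}\,\underline n$. The relation $\tilde\leadsto$ is the inductive family generated by: - $\mathsf{pred}\,\underline0\tilde\leadsto\underline0$; - $\mathsf{pred}\,\underline{n+1}\tilde\leadsto\underline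 n$; - $\mathsf{ifz}\,s\,t\,\underline0\tilde\leadsto s$; - $\mathsf{ifz}\,s\,t\,\underline{n+1}\tilde\leadsto t$; - $\mathsf k s t\tilde\leadsto s$; - $\mathsf s f g t\tilde\leadsto ft(gt)$; - $\mathsf{fix}\,f\tilde\leadsto f(\mathsf{fix}\,f)$; - if $f\tilde\leadsto g$ then $ft\tilde\leadsto gt$; - if $s\tilde\leadsto t$ then $\mathsf{succ}\,s\tilde\leadsto\mathsf{succ}\,t$ and $\mathsf{pred}\,s\tilde\leadsto\mathsf{pred}\,t$; - if $r\tilde\leadsto r'$ then $\mathsf{ifz}\,s\,t\,r\tilde\leadsto\mathsf{ifz}\,s\,t\,r'$. Set $s\leadsto t:=\|s\tilde\leadsto t\|$. For a proposition-valued relation $R$, $R_*$ is the inductive family with constructors $\mathsf{extend}:xRy\to xR_*y$, $\mathsf{refl}:xR_*x$ and $\mathsf{trans}:xR_*y\to yR_*z\to xR_*z$. Its truncation is $xR^*y:=\|xR_*y\|$, and $\leadsto^*$ is this closure of $\leadsto$. Semantics. The lifting is $\mathcal L(X):=\sum_{P:\Omega}(P\to X)$ with $\mathrm{isdefined}$ the first projection and $\mathrm{value}(P,\varphi)(p)=\varphi(p)$. We write $\eta(x):=(\mathbf 1,\lambda t.x)$ and $\bot:=(\mathbf 0,!)$. For a set $X$, $\mathcal L(X)$ is a dcpo with $\bot$, with order $l\sqsubseteq m:=(\mathrm{isdefined}(l)\to l=m)$. A dcpo with $\bot$ is a poset with a least element and least upper bounds of all directed families indexed by types in $\mathcal U_0$.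 A family $u:I\to X$ is directed if $\|I\|$ holds and $\prod_{i,j}\|\sum_k u_i\le u_k\times u_j\le u_k\|$. For dcpos with $\bot$ $D,E$, $E^D$ is the dcpo with $\bot$ of continuous maps, ordered pointwise. Interpretation of types: $[\![\iota]\!]:=\mathcal L(\mathbb N)$ and $[\![\sigma\Rightarrow\tau]\!]:=[\![\tau]\!]^{[\![\sigma]\!]}$. Interpretation of terms: - $[\![\mathsf{zero}]\!]=\eta(0)$; - $[\![\mathsf{succ}]\!]=\mathcal L(\mathrm{succ})$ and $[\![\mathsf{pred}]\!]=\mathcal L(\mathrm{pred})$, where $\mathcal L(f)(P,\varphi)=(P,f\circ\varphi)$; - $[\![\mathsf{ifz}]\!]=\lambda x,y.(\chi_{x,y})^\#$, where $\chi_{x,y}(0)=x$, $\chi_{x,y}(n+1)=y$, and $g^\#(P,\varphi)=(\sum_{p:P}\mathrm{isdefined}(g(\varphi p)),(p,d)\mapsto\mathrm{value}(g(\varphi p))(d))$; - $[\![\mathsf k]\!]=\lambda x,y.x$; - $[\![\mathsf s]\!]=\lambda f,g,x.f(x)(g(x))$; - $[\![\mathsf{fix}]\!]=\mu$ with $\mu(f)=\bigsqcup_n f^n(\bot)$; - $[\![st]\!]=[\![s]\!]([\![t]\!])$. -}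

module Defs where

open import Level using (Level; Setω) renaming (_⊔_ to _⊔ℓ_)
open import Function using (_∘_)
open import Data.Nat using (ℕ; zero; suc; pred; _≤_; z≤n; s≤s) renaming (_⊔_ to max)
open import Data.Nat.Properties using (m≤m⊔n; m≤n⊔m) renaming (≡-irrelevant to ℕ-set)
open import Data.Bool using (Bool; true; false)
open import Data.Unit using (⊤; tt)
open import Data.Empty using (⊥)
open import Data.Product using (Σ; _×_; _,_; proj₁; proj₂)
open import Relation.Binary.PropositionalEquality
  using (_≡_; refl; sym; trans; cong; cong₂; subst)
import Axiom.UniquenessOfIdentityProofs as UIPmod

private variable ℓ ℓ' : Level

isProp : Set ℓ → Set ℓ
isProp A = (x y : A) → x ≡ y

isSet : Set ℓ → Set ℓ
isSet A = (x y : A) → isProp (x ≡ y)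

infixr 30 _⇒_
data Ty : Set where
  ι   : Ty
  _⇒_ : Ty → Ty → Ty

infixl 40 _·_
data Term : Ty → Set where
  Zero : Term ι
  Succ : Term (ι ⇒ ι)
  Pred : Term (ι ⇒ ι)
  Ifz  : Term (ι ⇒ ι ⇒ ι ⇒ ι)
  K    : {σ τ : Ty} → Term (σ ⇒ τ ⇒ σ)
  S    : {σ τ ρ : Ty} → Term ((σ ⇒ τ ⇒ ρ) ⇒ (σ ⇒ τ) ⇒ σ ⇒ ρ)
  Fix  : {σ : Ty} → Term ((σ ⇒ σ) ⇒ σ)
  _·_  : {σ τ : Ty} → Term (σ ⇒ τ) → Term σ → Term τ

numeral : ℕ → Term ι
numeral zero    = Zero
numeral (suc n) = Succ · numeral n

infix 4 _~>_
data _~>_ : {σ : Ty} → Term σ → Term σ → Set where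
  pred-zero : Pred · numeral 0 ~> numeral 0
  pred-suc  : (n : ℕ) → Pred · numeral (suc n) ~> numeral n
  ifz-zero  : (s t : Term ι) → Ifz · s · t · numeral 0 ~> s
  ifz-suc   : (s t : Term ι) (n : ℕ) → Ifz · s · t · numeral (suc n) ~> t
  k-red     : {σ τ : Ty} (s : Term σ) (t : Term τ) → K · s · t ~> s
  s-red     : {σ τ ρ : Ty} (f : Term (σ ⇒ τ ⇒ ρ)) (g : Term (σ ⇒ τ)) (t : Term σ)
            → S · f · g · t ~> f · t · (g · t)
  fix-red   : {σ : Ty} (f : Term (σ ⇒ σ)) → Fix · f ~> f · (Fix · f)
  app-cong  : {σ τ : Ty} {f g : Term (σ ⇒ τ)} (t : Term σ) → f ~> g → f · t ~> g · t
  succ-cong : {s t : Term ι} → s ~> t → Succ · s ~> Succ · t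
  pred-cong : {s t : Term ι} → s ~> t → Pred · s ~> Pred · t
  ifz-cong  : (s t : Term ι) {r r' : Term ι} → r ~> r' → Ifz · s · t · r ~> Ifz · s · t · r'

data Closure {A : Set ℓ} (R : A → A → Set ℓ') : A → A → Set (ℓ ⊔ℓ ℓ') where
  extend : {x y : A} → R x y → Closure R x y
  refl*  : {x : A} → Closure R x x
  trans* : {x y z : A} → Closure R x y → Closure R y z → Closure R x z

record Axioms : Setω where
  field
    ∥_∥       : {ℓ : Level} → Set ℓ → Set ℓ
    ∣_∣       : {ℓ : Level} {A : Set ℓ} → A → ∥ A ∥
    ∥∥-isProp : {ℓ : Level} {A : Set ℓ} → isProp ∥ A ∥
    ∥∥-rec    : {ℓ ℓ' : Level} {A : Set ℓ} {B : Set ℓ'} → isProp B → (A → B) → ∥ A ∥ → B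
    funext    : {ℓ ℓ' : Level} {A : Set ℓ} {B : A → Set ℓ'} {f g : (x : A) → B x}
              → ((x : A) → f x ≡ g x) → f ≡ g
    propext   : {ℓ : Level} {P Q : Set ℓ} → isProp P → isProp Q → (P → Q) → (Q → P) → P ≡ Q

module Semantics (ax : Axioms) where
  open Axioms ax public

  infix 4 _⇝_ _⇝*_
  _⇝_ : {σ : Ty} → Term σ → Term σ → Set
  s ⇝ t = ∥ s ~> t ∥

  _* : {A : Set} (R : A → A → Set) → A → A → Set
  (R *) x y = ∥ Closure R x y ∥

  _⇝*_ : {σ : Ty} → Term σ → Term σ → Set
  s ⇝* t = (_⇝_ *) s t

  ∥∥-map : {A : Set ℓ} {B : Set ℓ'} → (A → B) → ∥ A ∥ → ∥ B ∥
  ∥∥-map f = ∥∥-rec ∥∥-isProp (λ a → ∣ f a ∣)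

  Σ-prop-≡ : {A : Set ℓ} {B : A → Set ℓ'} → ((a : A) → isProp (B a))
           → {x y : Σ A B} → proj₁ x ≡ proj₁ y → x ≡ y
  Σ-prop-≡ pB {a , b} {.a , b'} refl = cong (a ,_) (pB a b b')

  ×-prop : {A : Set ℓ} {B : Set ℓ'} → isProp A → isProp B → isProp (A × B)
  ×-prop pA pB (a , b) (a' , b') = cong₂ _,_ (pA a a') (pB b b')

  prop→set : {A : Set ℓ} → isProp A → isSet A
  prop→set {A = A} p x y = UIPmod.Constant⇒UIP.≡-irrelevant f (λ _ _ → refl)
    where
    f : {a b : A} → a ≡ b → a ≡ b
    f {a} {b} _ = trans (sym (p a a)) (p a b)

  isProp-isProp : {A : Set ℓ} → isProp (isProp A)
  isProp-isProp p q = funext λ x → funext λ y → prop→set p x y (p x y) (q x y)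

  Π-prop : {A : Set ℓ} {B : A → Set ℓ'} → ((a : A) → isProp (B a)) → isProp ((a : A) → B a)
  Π-prop pB f g = funext λ a → pB a (f a) (g a)

  Πi-prop : {A : Set ℓ} {B : A → Set ℓ'} → ((a : A) → isProp (B a)) → isProp ({a : A} → B a)
  Πi-prop pB f g = cong (λ h {a} → h a) (funext λ a → pB a (f {a}) (g {a}))

  module Factor {A : Set ℓ} {X : Set ℓ'} (Xset : isSet X) (f : A → X)
                (fc : (a b : A) → f a ≡ f b) where
    private
      Img : Set (ℓ ⊔ℓ ℓ')
      Img = Σ X (λ x → ∥ Σ A (λ a → f a ≡ x) ∥)

      Img-prop : isProp Img
      Img-prop (x , h) (y , h') = Σ-prop-≡ (λ _ → ∥∥-isProp)
        (∥∥-rec (Xset x y) (λ (a , e) → ∥∥-rec (Xset x y)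
          (λ (b , e') → trans (sym e) (trans (fc a b) e')) h') h)

      img : ∥ A ∥ → Img
      img = ∥∥-rec Img-prop (λ a → f a , ∣ a , refl ∣)

    factor : ∥ A ∥ → X
    factor h = proj₁ (img h)

    factor-β : (h : ∥ A ∥) (a : A) → factor h ≡ f a
    factor-β h a = ∥∥-rec (Xset _ _) (λ (b , e) → trans (sym e) (fc b a)) (proj₂ (img h))

  -- Propositions and the lifting

  Ω : Set₁
  Ω = Σ Set isProp

  𝓛 : Set → Set₁
  𝓛 X = Σ Ω (λ P → proj₁ P → X)

  isdefined : {X : Set} → 𝓛 X → Set
  isdefined l = proj₁ (proj₁ l)

  isdefined-prop : {X : Set} (l : 𝓛 X) → isProp (isdefined l)
  isdefined-prop l = proj₂ (proj₁ l)

  value : {X : Set} (l : 𝓛 X) → isdefined l → X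
  value l = proj₂ l

  η : {X : Set} → X → 𝓛 X
  η x = (⊤ , (λ _ _ → refl)) , (λ _ → x)

  ⊥𝓛 : {X : Set} → 𝓛 X
  ⊥𝓛 = (⊥ , (λ ())) , (λ ())

  𝓛map : {X Y : Set} → (X → Y) → 𝓛 X → 𝓛 Y
  𝓛map f l = proj₁ l , (f ∘ value l)

  Σ-prop : {A : Set ℓ} {B : A → Set ℓ'} → isProp A → ((a : A) → isProp (B a)) → isProp (Σ A B)
  Σ-prop {B = B} pA pB (a , b) (a' , b') = lemma (pA a a') b b'
    where
    lemma : {x y : _} (e : x ≡ y) (b : B x) (b' : B y) → (x , b) ≡ (y , b')
    lemma {x} refl b b' = cong (x ,_) (pB x b b')

  _♯ : {X Y : Set} → (X → 𝓛 Y) → 𝓛 X → 𝓛 Y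
  (g ♯) l =
    (Σ (isdefined l) (λ p → isdefined (g (value l p))) ,
       Σ-prop (isdefined-prop l) (λ p → isdefined-prop (g (value l p)))) ,
    (λ pd → value (g (value l (proj₁ pd))) (proj₂ pd))

  L-ext-lemma : {X : Set} {P Q : Set} (e : P ≡ Q) (pP : isProp P) (pQ : isProp Q)
                (φ : P → X) (ψ : Q → X) → ((p : P) (q : Q) → φ p ≡ ψ q)
              → _≡_ {A = 𝓛 X} ((P , pP) , φ) ((Q , pQ) , ψ)
  L-ext-lemma refl pP pQ φ ψ v =
    cong₂ (λ a b → (_ , a) , b) (isProp-isProp pP pQ) (funext λ p → v p p)

  L-ext : {X : Set} (l m : 𝓛 X) → (isdefined l → isdefined m) → (isdefined m → isdefined l)
        → ((p : isdefined l) (q : isdefined m) → value l p ≡ value m q) → l ≡ m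
  L-ext ((P , pP) , φ) ((Q , pQ) , ψ) f g v = L-ext-lemma (propext pP pQ f g) pP pQ φ ψ v

  ≡-value : {X : Set} {l m : 𝓛 X} (e : l ≡ m) (p : isdefined l) (q : isdefined m)
          → value l p ≡ value m q
  ≡-value {l = l} refl p q = cong (value l) (isdefined-prop l p q)

  𝓛-set : {X : Set} → isSet X → isSet (𝓛 X)
  𝓛-set {X} Xset l m = UIPmod.Constant⇒UIP.≡-irrelevant f fc
    where
    f : {a b : 𝓛 X} → a ≡ b → a ≡ b
    f {a} {b} e = L-ext a b (subst isdefined e) (subst isdefined (sym e)) (≡-value e)
    fc : {a b : 𝓛 X} (e e' : a ≡ b) → f e ≡ f e'
    fc {a} {b} e e' =
      cong₂ (λ u v → L-ext a b u v (≡-value e))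
            (funext λ p → isdefined-prop b _ _) (funext λ p → isdefined-prop a _ _)
      ∙ cong (L-ext a b (subst isdefined e') (subst isdefined (sym e')))
             (funext λ p → funext λ q → Xset _ _ _ _)
      where
      _∙_ : {A : Set₁} {x y z : A} → x ≡ y → y ≡ z → x ≡ z
      _∙_ = trans

  isDirected : {C : Set₁} (_≤_ : C → C → Set₁) {I : Set} → (I → C) → Set₁
  isDirected _≤_ {I} α = ∥ I ∥ × ((i j : I) → ∥ Σ I (λ k → (α i ≤ α k) × (α j ≤ α k)) ∥)

  isSup : {C : Set₁} (_≤_ : C → C → Set₁) {I : Set} → (I → C) → C → Set₁
  isSup {C} _≤_ {I} α s = ((i : I) → α i ≤ s) × ((u : C) → ((i : I) → α i ≤ u) → s ≤ u)

  record DCPO : Set₂ where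
    field
      Carrier     : Set₁
      _⊑_         : Carrier → Carrier → Set₁
      Carrier-set : isSet Carrier
      ⊑-prop      : (x y : Carrier) → isProp (x ⊑ y)
      ⊑-refl      : (x : Carrier) → x ⊑ x
      ⊑-trans     : {x y z : Carrier} → x ⊑ y → y ⊑ z → x ⊑ z
      ⊑-antisym   : {x y : Carrier} → x ⊑ y → y ⊑ x → x ≡ y
      ⊥ᴰ          : Carrier
      ⊥-least     : (x : Carrier) → ⊥ᴰ ⊑ x
      ∐           : {I : Set} (α : I → Carrier) → isDirected _⊑_ α → Carrier
      ∐-isSup     : {I : Set} (α : I → Carrier) (δ : isDirected _⊑_ α) → isSup _⊑_ α (∐ α δ)

  poset-set : {C : Set₁} (_≤_ : C → C → Set₁) → ((x y : C) → isProp (x ≤ y))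
            → ((x : C) → x ≤ x) → ({x y : C} → x ≤ y → y ≤ x → x ≡ y) → isSet C
  poset-set {C} _≤_ pr rf an x y = UIPmod.Constant⇒UIP.≡-irrelevant f fc
    where
    f : {a b : C} → a ≡ b → a ≡ b
    f {a} {b} e = an (subst (a ≤_) e (rf a)) (subst (_≤ a) e (rf a))
    fc : {a b : C} (e e' : a ≡ b) → f e ≡ f e'
    fc {a} {b} e e' = cong₂ an (pr _ _ _ _) (pr _ _ _ _)

  isSup-prop : {C : Set₁} (_≤_ : C → C → Set₁) → ((x y : C) → isProp (x ≤ y))
             → {I : Set} (α : I → C) (s : C) → isProp (isSup _≤_ α s)
  isSup-prop _≤_ pr α s = ×-prop (Π-prop λ i → pr _ _) (Π-prop λ u → Π-prop λ _ → pr _ _)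

  _⊑𝓛_ : {X : Set} → 𝓛 X → 𝓛 X → Set₁
  l ⊑𝓛 m = isdefined l → l ≡ m

  module 𝓛Sup {X : Set} (Xset : isSet X) {I : Set} (α : I → 𝓛 X) (δ : isDirected _⊑𝓛_ α) where
    private
      f : Σ I (λ i → isdefined (α i)) → X
      f (i , d) = value (α i) d

      fc : (a b : Σ I (λ i → isdefined (α i))) → f a ≡ f b
      fc (i , d) (j , e) =
        ∥∥-rec (Xset _ _) (λ (k , u , v) → ≡-value (trans (u d) (sym (v e))) d e) (proj₂ δ i j)

    open Factor Xset f fc public

    sup : 𝓛 X
    sup = (∥ Σ I (λ i → isdefined (α i)) ∥ , ∥∥-isProp) , factor

    sup-isSup : isSup _⊑𝓛_ α sup
    sup-isSup = upper , least
      where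
      upper : (i : I) → α i ⊑𝓛 sup
      upper i d = L-ext (α i) sup (λ _ → ∣ i , d ∣) (λ _ → d)
        (λ p q → trans (cong (value (α i)) (isdefined-prop (α i) p d)) (sym (factor-β q (i , d))))
      least : (u : 𝓛 X) → ((i : I) → α i ⊑𝓛 u) → sup ⊑𝓛 u
      least u up h = L-ext sup u
        (λ h' → ∥∥-rec (isdefined-prop u) (λ (i , d) → subst isdefined (up i d) d) h')
        (λ _ → h)
        (λ p q → ∥∥-rec (Xset _ _) (λ (i , d) → trans (factor-β p (i , d)) (≡-value (up i d) d q)) p)

  𝓛-DCPO : (X : Set) → isSet X → DCPO
  𝓛-DCPO X Xset = record
    { Carrier     = 𝓛 X
    ; _⊑_         = _⊑𝓛_
    ; Carrier-set = 𝓛-set Xset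
    ; ⊑-prop      = λ l m → Π-prop (λ _ → 𝓛-set Xset l m)
    ; ⊑-refl      = λ l _ → refl
    ; ⊑-trans     = λ {l} {m} {n} u v d → trans (u d) (v (subst isdefined (u d) d))
    ; ⊑-antisym   = λ {l} {m} u v → antisym l m u v
    ; ⊥ᴰ          = ⊥𝓛
    ; ⊥-least     = λ l ()
    ; ∐           = λ α δ → 𝓛Sup.sup Xset α δ
    ; ∐-isSup     = λ α δ → 𝓛Sup.sup-isSup Xset α δ
    }
    where
    antisym : (l m : 𝓛 X) → l ⊑𝓛 m → m ⊑𝓛 l → l ≡ m
    antisym l m u v = L-ext l m (λ d → subst isdefined (u d) d) (λ d → subst isdefined (v d) d)
      (λ p q → ≡-value (u p) p q)

  isContinuous : (D E : DCPO) → (DCPO.Carrier D → DCPO.Carrier E) → Set₁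
  isContinuous D E f = {I : Set} (α : I → D.Carrier) (δ : isDirected D._⊑_ α)
                     → isSup E._⊑_ (f ∘ α) (f (D.∐ α δ))
    where
    module D = DCPO D
    module E = DCPO E

  isContinuous-prop : (D E : DCPO) (f : DCPO.Carrier D → DCPO.Carrier E) → isProp (isContinuous D E f)
  isContinuous-prop D E f = Πi-prop λ I → Π-prop λ α → Π-prop λ δ →
    isSup-prop (DCPO._⊑_ E) (DCPO.⊑-prop E) _ _

  module Exponential (D E : DCPO) where
    private
      module D = DCPO D
      module E = DCPO E

    Cont : Set₁
    Cont = Σ (D.Carrier → E.Carrier) (isContinuous D E)

    _⊑→_ : Cont → Cont → Set₁
    f ⊑→ g = (x : D.Carrier) → proj₁ f x E.⊑ proj₁ g x

    ⊑→-prop : (f g : Cont) → isProp (f ⊑→ g)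
    ⊑→-prop f g = Π-prop λ x → E.⊑-prop _ _

    ⊑→-antisym : {f g : Cont} → f ⊑→ g → g ⊑→ f → f ≡ g
    ⊑→-antisym u v = Σ-prop-≡ (isContinuous-prop D E) (funext λ x → E.⊑-antisym (u x) (v x))

    ⊥→ : Cont
    ⊥→ = (λ _ → E.⊥ᴰ) , (λ α δ → (λ i → E.⊑-refl _) , (λ u _ → E.⊥-least u))

    module _ {I : Set} (α : I → Cont) (δ : isDirected _⊑→_ α) where
      at : D.Carrier → I → E.Carrier
      at x i = proj₁ (α i) x

      at-dir : (x : D.Carrier) → isDirected E._⊑_ (at x)
      at-dir x = proj₁ δ , λ i j → ∥∥-map (λ (k , u , v) → k , u x , v x) (proj₂ δ i j)

      sup-fun : D.Carrier → E.Carrier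
      sup-fun x = E.∐ (at x) (at-dir x)

      sup-fun-cont : isContinuous D E sup-fun
      sup-fun-cont β ε = upper , least
        where
        upper : (j : _) → sup-fun (β j) E.⊑ sup-fun (D.∐ β ε)
        upper j = proj₂ (E.∐-isSup (at (β j)) (at-dir (β j))) _
          (λ i → E.⊑-trans (proj₁ (proj₂ (α i) β ε) j)
                           (proj₁ (E.∐-isSup (at (D.∐ β ε)) (at-dir (D.∐ β ε))) i))
        least : (u : E.Carrier) → ((j : _) → sup-fun (β j) E.⊑ u) → sup-fun (D.∐ β ε) E.⊑ u
        least u h = proj₂ (E.∐-isSup (at (D.∐ β ε)) (at-dir (D.∐ β ε))) u
          (λ i → proj₂ (proj₂ (α i) β ε) u
            (λ j → E.⊑-trans (proj₁ (E.∐-isSup (at (β j)) (at-dir (β j))) i) (h j)))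

      sup→ : Cont
      sup→ = sup-fun , sup-fun-cont

      sup→-isSup : isSup _⊑→_ α sup→
      sup→-isSup = (λ i x → proj₁ (E.∐-isSup (at x) (at-dir x)) i)
                 , (λ g h x → proj₂ (E.∐-isSup (at x) (at-dir x)) _ (λ i → h i x))

  _⟹_ : DCPO → DCPO → DCPO
  D ⟹ E = record
    { Carrier     = Cont
    ; _⊑_         = _⊑→_
    ; Carrier-set = poset-set _⊑→_ ⊑→-prop (λ f x → E.⊑-refl _) ⊑→-antisym
    ; ⊑-prop      = ⊑→-prop
    ; ⊑-refl      = λ f x → E.⊑-refl _
    ; ⊑-trans     = λ u v x → E.⊑-trans (u x) (v x)
    ; ⊑-antisym   = ⊑→-antisym
    ; ⊥ᴰ          = ⊥→
    ; ⊥-least     = λ f x → E.⊥-least _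
    ; ∐           = sup→
    ; ∐-isSup     = sup→-isSup
    }
    where
    module E = DCPO E
    open Exponential D E

  module _ (D : DCPO) where
    private module D = DCPO D

    sup-≡ : {I : Set} (α : I → D.Carrier) (δ : isDirected D._⊑_ α) (s : D.Carrier)
          → isSup D._⊑_ α s → s ≡ D.∐ α δ
    sup-≡ α δ s (up , lst) =
      D.⊑-antisym (lst _ (proj₁ (D.∐-isSup α δ))) (proj₂ (D.∐-isSup α δ) s up)

    const-isSup : {I : Set} → ∥ I ∥ → (x : D.Carrier) → isSup D._⊑_ {I} (λ _ → x) x
    const-isSup i x = (λ _ → D.⊑-refl x) , (λ u h → ∥∥-rec (D.⊑-prop _ _) h i)

    const-dir : {I : Set} → ∥ I ∥ → (x : D.Carrier) → isDirected D._⊑_ {I} (λ _ → x)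
    const-dir i x = i , (λ j k → ∣ j , D.⊑-refl x , D.⊑-refl x ∣)

  module _ (D E : DCPO) where
    private
      module D = DCPO D
      module E = DCPO E

    cont→mono : (f : D.Carrier → E.Carrier) → isContinuous D E f
              → {x y : D.Carrier} → x D.⊑ y → f x E.⊑ f y
    cont→mono f c {x} {y} le = subst (λ z → f x E.⊑ f z) e (proj₁ (c β δ) true)
      where
      β : Bool → D.Carrier
      β true  = x
      β false = y
      ub : (i : Bool) → β i D.⊑ y
      ub true  = le
      ub false = D.⊑-refl y
      δ : isDirected D._⊑_ β
      δ = ∣ true ∣ , (λ i j → ∣ false , ub i , ub j ∣)
      e : D.∐ β δ ≡ y
      e = D.⊑-antisym (proj₂ (D.∐-isSup β δ) y ub) (proj₁ (D.∐-isSup β δ) false)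

    image-dir : (f : D.Carrier → E.Carrier) → ({x y : D.Carrier} → x D.⊑ y → f x E.⊑ f y)
              → {I : Set} (α : I → D.Carrier) → isDirected D._⊑_ α → isDirected E._⊑_ (f ∘ α)
    image-dir f m α δ = proj₁ δ , (λ i j → ∥∥-map (λ (k , u , v) → k , m u , m v) (proj₂ δ i j))

    open Exponential D E

    pointwise→isSup : {I : Set} (α : I → Cont) (F : Cont)
                    → ((x : D.Carrier) → isSup E._⊑_ (λ i → proj₁ (α i) x) (proj₁ F x))
                    → isSup _⊑→_ α F
    pointwise→isSup α F h = (λ i x → proj₁ (h x) i) , (λ G H x → proj₂ (h x) (proj₁ G x) (λ i → H i x))

    isSup→pointwise : {I : Set} (α : I → Cont) (δ : isDirected _⊑→_ α) (F : Cont)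
                    → isSup _⊑→_ α F
                    → (x : D.Carrier) → isSup E._⊑_ (λ i → proj₁ (α i) x) (proj₁ F x)
    isSup→pointwise α δ F (up , lst) x =
      (λ i → up i x) ,
      (λ u h → E.⊑-trans (lst (sup→ α δ) (proj₁ (sup→-isSup α δ)) x)
                         (proj₂ (E.∐-isSup (at α δ x) (at-dir α δ x)) u h))

  module _ (D E : DCPO) where
    private
      module D = DCPO D
      module E = DCPO E

    kconst : D.Carrier → DCPO.Carrier (E ⟹ D)
    kconst x = (λ _ → x) , (λ α δ → const-isSup D (proj₁ δ) x)

    kᴰ : DCPO.Carrier (D ⟹ (E ⟹ D))
    kᴰ = kconst , (λ α δ → pointwise→isSup E D (kconst ∘ α) (kconst (D.∐ α δ)) (λ _ → D.∐-isSup α δ))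

  module _ (D E F : DCPO) where
    private
      module D = DCPO D
      module E = DCPO E
      module F = DCPO F

    ev-cont : (f : DCPO.Carrier (D ⟹ (E ⟹ F))) (g : DCPO.Carrier (D ⟹ E))
            → isContinuous D F (λ x → proj₁ (proj₁ f x) (proj₁ g x))
    ev-cont f g α δ = upper , least
      where
      f₀ = proj₁ f
      g₀ = proj₁ g
      gα-dir : isDirected E._⊑_ (g₀ ∘ α)
      gα-dir = image-dir D E g₀ (cont→mono D E g₀ (proj₂ g)) α δ
      g∐ : g₀ (D.∐ α δ) ≡ E.∐ (g₀ ∘ α) gα-dir
      g∐ = sup-≡ E (g₀ ∘ α) gα-dir _ (proj₂ g α δ)
      fmono : {x y : D.Carrier} → x D.⊑ y → DCPO._⊑_ (E ⟹ F) (f₀ x) (f₀ y)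
      fmono = cont→mono D (E ⟹ F) f₀ (proj₂ f)
      gmono : {x y : D.Carrier} → x D.⊑ y → g₀ x E.⊑ g₀ y
      gmono = cont→mono D E g₀ (proj₂ g)
      fxmono : (x : D.Carrier) {y z : E.Carrier} → y E.⊑ z → proj₁ (f₀ x) y F.⊑ proj₁ (f₀ x) z
      fxmono x = cont→mono E F (proj₁ (f₀ x)) (proj₂ (f₀ x))
      upper : (i : _) → proj₁ (f₀ (α i)) (g₀ (α i)) F.⊑ proj₁ (f₀ (D.∐ α δ)) (g₀ (D.∐ α δ))
      upper i = F.⊑-trans (fxmono (α i) (proj₁ (proj₂ g α δ) i)) (proj₁ (proj₂ f α δ) i _)
      least : (u : F.Carrier) → ((i : _) → proj₁ (f₀ (α i)) (g₀ (α i)) F.⊑ u)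
            → proj₁ (f₀ (D.∐ α δ)) (g₀ (D.∐ α δ)) F.⊑ u
      least u h = proj₂ (isSup→pointwise E F (f₀ ∘ α) (image-dir D (E ⟹ F) f₀ fmono α δ)
                          (f₀ (D.∐ α δ)) (proj₂ f α δ) (g₀ (D.∐ α δ))) u step
        where
        step : (i : _) → proj₁ (f₀ (α i)) (g₀ (D.∐ α δ)) F.⊑ u
        step i = subst (λ z → proj₁ (f₀ (α i)) z F.⊑ u) (sym g∐)
          (proj₂ (proj₂ (f₀ (α i)) (g₀ ∘ α) gα-dir) u
            (λ j → ∥∥-rec (F.⊑-prop _ _)
              (λ (k , a , b) → F.⊑-trans (fxmono (α i) (gmono b))
                                (F.⊑-trans (fmono a (g₀ (α k))) (h k)))
              (proj₂ δ i j)))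

    s₃ : DCPO.Carrier (D ⟹ (E ⟹ F)) → DCPO.Carrier (D ⟹ E) → DCPO.Carrier (D ⟹ F)
    s₃ f g = (λ x → proj₁ (proj₁ f x) (proj₁ g x)) , ev-cont f g

    s₂ : DCPO.Carrier (D ⟹ (E ⟹ F)) → DCPO.Carrier ((D ⟹ E) ⟹ (D ⟹ F))
    s₂ f = s₃ f , (λ α δ → pointwise→isSup D F (s₃ f ∘ α) (s₃ f (DCPO.∐ (D ⟹ E) α δ)) (λ x →
                   proj₂ (proj₁ f x) (λ i → proj₁ (α i) x)
                         (Exponential.at-dir D E α δ x)))

    sᴰ : DCPO.Carrier ((D ⟹ (E ⟹ F)) ⟹ ((D ⟹ E) ⟹ (D ⟹ F)))
    sᴰ = s₂ , (λ α δ → pointwise→isSup (D ⟹ E) (D ⟹ F) (s₂ ∘ α) (s₂ (DCPO.∐ (D ⟹ (E ⟹ F)) α δ)) (λ g →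
                    pointwise→isSup D F (λ i → s₃ (α i) g) (s₃ (DCPO.∐ (D ⟹ (E ⟹ F)) α δ) g) (λ x →
                      DCPO.∐-isSup F (λ i → proj₁ (proj₁ (α i) x) (proj₁ g x))
                        (Exponential.at-dir E F (λ i → proj₁ (α i) x)
                           (Exponential.at-dir D (E ⟹ F) α δ x) (proj₁ g x)))))

  -- The least fixed point operator μ

  module _ (D : DCPO) where
    private
      module D = DCPO D
      module DD = DCPO (D ⟹ D)

    iter : DD.Carrier → ℕ → D.Carrier
    iter f zero    = D.⊥ᴰ
    iter f (suc n) = proj₁ f (iter f n)

    private
      mono : (f : DD.Carrier) {x y : D.Carrier} → x D.⊑ y → proj₁ f x D.⊑ proj₁ f y
      mono f = cont→mono D D (proj₁ f) (proj₂ f)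

    iter-mono : (f : DD.Carrier) {i k : ℕ} → i ≤ k → iter f i D.⊑ iter f k
    iter-mono f z≤n     = D.⊥-least _
    iter-mono f (s≤s p) = mono f (iter-mono f p)

    iter-dir : (f : DD.Carrier) → isDirected D._⊑_ (iter f)
    iter-dir f = ∣ 0 ∣ , (λ i j → ∣ max i j , iter-mono f (m≤m⊔n i j) , iter-mono f (m≤n⊔m i j) ∣)

    μ : DD.Carrier → D.Carrier
    μ f = D.∐ (iter f) (iter-dir f)

    private
      iter-le : {f g : DD.Carrier} → f DD.⊑ g → (n : ℕ) → iter f n D.⊑ iter g n
      iter-le le zero    = D.⊑-refl _
      iter-le {f} {g} le (suc n) = D.⊑-trans (mono f (iter-le le n)) (le (iter g n))

    μ-mono : {f g : DD.Carrier} → f DD.⊑ g → μ f D.⊑ μ g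
    μ-mono {f} {g} le = proj₂ (D.∐-isSup (iter f) (iter-dir f)) _
      (λ n → D.⊑-trans (iter-le le n) (proj₁ (D.∐-isSup (iter g) (iter-dir g)) n))

    μ-fix : (f : DD.Carrier) → proj₁ f (μ f) D.⊑ μ f
    μ-fix f = proj₂ (proj₂ f (iter f) (iter-dir f)) _
      (λ n → proj₁ (D.∐-isSup (iter f) (iter-dir f)) (suc n))

    μ-least : (f : DD.Carrier) (x : D.Carrier) → proj₁ f x D.⊑ x → μ f D.⊑ x
    μ-least f x h = proj₂ (D.∐-isSup (iter f) (iter-dir f)) x step
      where
      step : (n : ℕ) → iter f n D.⊑ x
      step zero    = D.⊥-least x
      step (suc n) = D.⊑-trans (mono f (step n)) h

    μ-cont : isContinuous (D ⟹ D) D μ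
    μ-cont α δ = (λ i → μ-mono (proj₁ (DD.∐-isSup α δ) i)) , least
      where
      μα-dir : isDirected D._⊑_ (μ ∘ α)
      μα-dir = image-dir (D ⟹ D) D μ μ-mono α δ
      v : D.Carrier
      v = D.∐ (μ ∘ α) μα-dir
      pre : proj₁ (DD.∐ α δ) v D.⊑ v
      pre = proj₂ (D.∐-isSup _ (Exponential.at-dir D D α δ v)) v
        (λ i → proj₂ (proj₂ (α i) (μ ∘ α) μα-dir) v
          (λ j → ∥∥-rec (D.⊑-prop _ _)
            (λ (k , a , b) → D.⊑-trans (mono (α i) (μ-mono b))
              (D.⊑-trans (a (μ (α k)))
                (D.⊑-trans (μ-fix (α k)) (proj₁ (D.∐-isSup (μ ∘ α) μα-dir) k))))
            (proj₂ δ i j)))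
      least : (u : D.Carrier) → ((i : _) → μ (α i) D.⊑ u) → μ (DD.∐ α δ) D.⊑ u
      least u h = D.⊑-trans (μ-least (DD.∐ α δ) v pre) (proj₂ (D.∐-isSup (μ ∘ α) μα-dir) u h)

    μᴰ : DCPO.Carrier ((D ⟹ D) ⟹ D)
    μᴰ = μ , μ-cont

  𝓛ℕ : DCPO
  𝓛ℕ = 𝓛-DCPO ℕ (λ x y → ℕ-set)

  private
    𝓛ℕ-set : isSet (𝓛 ℕ)
    𝓛ℕ-set = 𝓛-set (λ x y → ℕ-set)

    ⊑-intro : (l m : 𝓛 ℕ) → (isdefined l → isdefined m)
            → ((p : isdefined l) (q : isdefined m) → value l p ≡ value m q) → l ⊑𝓛 m
    ⊑-intro l m f v d = L-ext l m f (λ _ → d) v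

    𝓛-least : {I : Set} (β : I → 𝓛 ℕ) (s : 𝓛 ℕ) → ((i : I) → β i ⊑𝓛 s)
            → (isdefined s → ∥ Σ I (λ i → isdefined (β i)) ∥)
            → (u : 𝓛 ℕ) → ((i : I) → β i ⊑𝓛 u) → s ⊑𝓛 u
    𝓛-least β s up cover u h d =
      ∥∥-rec (𝓛ℕ-set _ _) (λ (i , e) → trans (sym (up i e)) (h i e)) (cover d)

    sup-defined : {I : Set} (β : I → 𝓛 ℕ) (δ : isDirected _⊑𝓛_ β) (s : 𝓛 ℕ)
                → isSup _⊑𝓛_ β s → isdefined s → ∥ Σ I (λ i → isdefined (β i)) ∥
    sup-defined β δ s sp d = subst isdefined (sup-≡ 𝓛ℕ β δ s sp) d

  𝓛map-cont : (f : ℕ → ℕ) → isContinuous 𝓛ℕ 𝓛ℕ (𝓛map f)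
  𝓛map-cont f α δ = upper , 𝓛-least _ _ upper (λ h → h)
    where
    open 𝓛Sup (λ x y → ℕ-set) α δ
    upper : (i : _) → 𝓛map f (α i) ⊑𝓛 𝓛map f sup
    upper i = ⊑-intro _ _ (λ p → ∣ i , p ∣) (λ p h → cong f (sym (factor-β h (i , p))))

  ♯-cont : (g : ℕ → 𝓛 ℕ) → isContinuous 𝓛ℕ 𝓛ℕ (g ♯)
  ♯-cont g α δ = upper , 𝓛-least _ _ upper cover
    where
    open 𝓛Sup (λ x y → ℕ-set) α δ
    upper : (i : _) → (g ♯) (α i) ⊑𝓛 (g ♯) sup
    upper i = ⊑-intro _ _
      (λ (p , e) → ∣ i , p ∣ , subst (isdefined ∘ g) (sym (factor-β ∣ i , p ∣ (i , p))) e)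
      (λ (p , e) (h , e') → ≡-value (cong g (sym (factor-β h (i , p)))) e e')
    cover : isdefined ((g ♯) sup) → ∥ Σ _ (λ i → isdefined ((g ♯) (α i))) ∥
    cover (h , e) = ∥∥-map (λ (i , p) → i , p , subst (isdefined ∘ g) (factor-β h (i , p)) e) h

  ♯-mono : {g g' : ℕ → 𝓛 ℕ} → ((n : ℕ) → g n ⊑𝓛 g' n) → (l : 𝓛 ℕ) → (g ♯) l ⊑𝓛 (g' ♯) l
  ♯-mono {g} {g'} le l = ⊑-intro _ _
    (λ (p , e) → p , subst isdefined (le (value l p) e) e)
    (λ (p , e) (p' , e') → ≡-value (trans (le (value l p) e) (cong g' (cong (value l) (isdefined-prop l p p')))) e e')

  ♯-sup : {I : Set} (gs : I → ℕ → 𝓛 ℕ) (g : ℕ → 𝓛 ℕ)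
        → ((n : ℕ) → isDirected _⊑𝓛_ (λ i → gs i n))
        → ((n : ℕ) → isSup _⊑𝓛_ (λ i → gs i n) (g n))
        → (l : 𝓛 ℕ) → isSup _⊑𝓛_ (λ i → (gs i ♯) l) ((g ♯) l)
  ♯-sup gs g dir sp l = upper , 𝓛-least _ _ upper cover
    where
    upper : (i : _) → (gs i ♯) l ⊑𝓛 (g ♯) l
    upper i = ♯-mono (λ n → proj₁ (sp n) i) l
    cover : isdefined ((g ♯) l) → ∥ Σ _ (λ i → isdefined ((gs i ♯) l)) ∥
    cover (p , e) = ∥∥-map (λ (i , e') → i , p , e')
      (sup-defined _ (dir (value l p)) _ (sp (value l p)) e)

  χ : 𝓛 ℕ → 𝓛 ℕ → ℕ → 𝓛 ℕ
  χ x y zero    = x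
  χ x y (suc n) = y

  private
    ifz₃ : 𝓛 ℕ → 𝓛 ℕ → DCPO.Carrier (𝓛ℕ ⟹ 𝓛ℕ)
    ifz₃ x y = (χ x y ♯) , ♯-cont (χ x y)

    ifz₂ : 𝓛 ℕ → DCPO.Carrier (𝓛ℕ ⟹ (𝓛ℕ ⟹ 𝓛ℕ))
    ifz₂ x = ifz₃ x , (λ α δ → pointwise→isSup 𝓛ℕ 𝓛ℕ (ifz₃ x ∘ α) (ifz₃ x (DCPO.∐ 𝓛ℕ α δ))
               (♯-sup (λ i → χ x (α i)) (χ x (DCPO.∐ 𝓛ℕ α δ)) (dir α δ) (sp α δ)))
      where
      dir : {I : Set} (α : I → 𝓛 ℕ) (δ : isDirected _⊑𝓛_ α) (n : ℕ)
          → isDirected _⊑𝓛_ (λ i → χ x (α i) n)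
      dir α δ zero    = const-dir 𝓛ℕ (proj₁ δ) x
      dir α δ (suc n) = δ
      sp : {I : Set} (α : I → 𝓛 ℕ) (δ : isDirected _⊑𝓛_ α) (n : ℕ)
         → isSup _⊑𝓛_ (λ i → χ x (α i) n) (χ x (DCPO.∐ 𝓛ℕ α δ) n)
      sp α δ zero    = const-isSup 𝓛ℕ (proj₁ δ) x
      sp α δ (suc n) = DCPO.∐-isSup 𝓛ℕ α δ

  ifzᴰ : DCPO.Carrier (𝓛ℕ ⟹ (𝓛ℕ ⟹ (𝓛ℕ ⟹ 𝓛ℕ)))
  ifzᴰ = ifz₂ , (λ α δ → pointwise→isSup 𝓛ℕ (𝓛ℕ ⟹ 𝓛ℕ) (ifz₂ ∘ α) (ifz₂ (DCPO.∐ 𝓛ℕ α δ)) (λ y →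
             pointwise→isSup 𝓛ℕ 𝓛ℕ (λ i → ifz₃ (α i) y) (ifz₃ (DCPO.∐ 𝓛ℕ α δ) y)
               (♯-sup (λ i → χ (α i) y) (χ (DCPO.∐ 𝓛ℕ α δ) y) (dir α δ y) (sp α δ y))))
    where
    dir : {I : Set} (α : I → 𝓛 ℕ) (δ : isDirected _⊑𝓛_ α) (y : 𝓛 ℕ) (n : ℕ)
        → isDirected _⊑𝓛_ (λ i → χ (α i) y n)
    dir α δ y zero    = δ
    dir α δ y (suc n) = const-dir 𝓛ℕ (proj₁ δ) y
    sp : {I : Set} (α : I → 𝓛 ℕ) (δ : isDirected _⊑𝓛_ α) (y : 𝓛 ℕ) (n : ℕ)
       → isSup _⊑𝓛_ (λ i → χ (α i) y n) (χ (DCPO.∐ 𝓛ℕ α δ) y n)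
    sp α δ y zero    = DCPO.∐-isSup 𝓛ℕ α δ
    sp α δ y (suc n) = const-isSup 𝓛ℕ (proj₁ δ) y

  -- The Scott model of PCF

  ⟦_⟧ty : Ty → DCPO
  ⟦ ι ⟧ty     = 𝓛ℕ
  ⟦ σ ⇒ τ ⟧ty = ⟦ σ ⟧ty ⟹ ⟦ τ ⟧ty

  ⟦_⟧ : {σ : Ty} → Term σ → DCPO.Carrier ⟦ σ ⟧ty
  ⟦ Zero ⟧                = η 0
  ⟦ Succ ⟧                = 𝓛map suc , 𝓛map-cont suc
  ⟦ Pred ⟧                = 𝓛map pred , 𝓛map-cont pred
  ⟦ Ifz ⟧                 = ifzᴰ
  ⟦ K {σ} {τ} ⟧           = kᴰ ⟦ σ ⟧ty ⟦ τ ⟧ty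
  ⟦ S {σ} {τ} {ρ} ⟧       = sᴰ ⟦ σ ⟧ty ⟦ τ ⟧ty ⟦ ρ ⟧ty
  ⟦ Fix {σ} ⟧             = μᴰ ⟦ σ ⟧ty
  ⟦ s · t ⟧               = proj₁ ⟦ s ⟧ ⟦ t ⟧

module Submission where

-- Tait-style logical relation: a semantic value x is adequate for a term t at type ι when
-- every defined value of x is reached by t, and at σ ⇒ τ when adequate arguments are sent
-- to adequate results. Adequacy is closed under backwards reduction, holds for ⊥ and is
-- preserved by directed suprema; these three facts cover the combinators and fix, whose
-- meaning is the supremum of the iterates fⁿ(⊥). Hence every term is adequate for its
-- own denotation, which at type ι is the theorem.

open import Defs
open import Level using (Level; Lift; lift; lower)
open import Data.Nat using (ℕ; zero; suc; pred)
open import Data.Nat.Properties using (≡-irrelevant)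
open import Data.Product using (_,_; proj₁)
open import Relation.Binary.PropositionalEquality using (sym; subst)

Closure-map : {a b r s : Level} {A : Set a} {B : Set b}
              {R : A → A → Set r} {S : B → B → Set s} (F : A → B)
            → ({x y : A} → R x y → S (F x) (F y))
            → {x y : A} → Closure R x y → Closure S (F x) (F y)
Closure-map F f (extend r)   = extend (f r)
Closure-map F f refl*        = refl*
Closure-map F f (trans* a b) = trans* (Closure-map F f a) (Closure-map F f b)

module Adequacy (ax : Axioms) where
  open Semantics ax

  ~>⇒⇝* : {σ : Ty} {s t : Term σ} → s ~> t → s ⇝* t
  ~>⇒⇝* r = ∣ extend ∣ r ∣ ∣

  ⇝*-refl : {σ : Ty} {s : Term σ} → s ⇝* s
  ⇝*-refl = ∣ refl* ∣

  infixr 5 _⇝*-∘_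
  _⇝*-∘_ : {σ : Ty} {s t u : Term σ} → s ⇝* t → t ⇝* u → s ⇝* u
  a ⇝*-∘ b = ∥∥-rec ∥∥-isProp (λ a' → ∥∥-map (trans* a') b) a

  ⇝*-cong : {σ τ : Ty} (F : Term σ → Term τ) → ({s t : Term σ} → s ~> t → F s ~> F t)
          → {s t : Term σ} → s ⇝* t → F s ⇝* F t
  ⇝*-cong F f = ∥∥-map (Closure-map F (∥∥-map f))

  _Computes_ : Term ι → 𝓛 ℕ → Set
  t Computes l = (p : isdefined l) → t ⇝* numeral (value l p)

  Adequate : (σ : Ty) → DCPO.Carrier ⟦ σ ⟧ty → Term σ → Set₁
  Adequate ι       l t = Lift _ (t Computes l)
  Adequate (σ ⇒ τ) f s = (x : DCPO.Carrier ⟦ σ ⟧ty) (t : Term σ)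
                       → Adequate σ x t → Adequate τ (proj₁ f x) (s · t)

  Adequate-⇝* : (σ : Ty) {x : DCPO.Carrier ⟦ σ ⟧ty} {s s' : Term σ}
              → s ⇝* s' → Adequate σ x s' → Adequate σ x s
  Adequate-⇝* ι       r a = lift λ p → r ⇝*-∘ lower a p
  Adequate-⇝* (σ ⇒ τ) r a = λ x t at → Adequate-⇝* τ (⇝*-cong (_· t) (app-cong t) r) (a x t at)

  Adequate-⊥ : (σ : Ty) (t : Term σ) → Adequate σ (DCPO.⊥ᴰ ⟦ σ ⟧ty) t
  Adequate-⊥ ι       t = lift λ ()
  Adequate-⊥ (σ ⇒ τ) t = λ x s _ → Adequate-⊥ τ (t · s)

  Adequate-∐ : (σ : Ty) {I : Set} (α : I → DCPO.Carrier ⟦ σ ⟧ty)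
               (δ : isDirected (DCPO._⊑_ ⟦ σ ⟧ty) α) (t : Term σ)
             → ((i : I) → Adequate σ (α i) t) → Adequate σ (DCPO.∐ ⟦ σ ⟧ty α δ) t
  Adequate-∐ ι α δ t a = lift λ p → ∥∥-rec ∥∥-isProp
    (λ (i , d) → subst (λ n → t ⇝* numeral n)
                       (sym (𝓛Sup.factor-β (λ _ _ → ≡-irrelevant) α δ p (i , d)))
                       (lower (a i) d))
    p
  Adequate-∐ (σ ⇒ τ) α δ t a = λ x s as →
    Adequate-∐ τ (λ i → proj₁ (α i) x) (Exponential.at-dir ⟦ σ ⟧ty ⟦ τ ⟧ty α δ x) (t · s)
               (λ i → a i x s as)

  Pred-⇝* : (t : Term ι) (n : ℕ) → t ⇝* numeral n → Pred · t ⇝* numeral (pred n)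
  Pred-⇝* t zero    r = ⇝*-cong (Pred ·_) pred-cong r ⇝*-∘ ~>⇒⇝* pred-zero
  Pred-⇝* t (suc n) r = ⇝*-cong (Pred ·_) pred-cong r ⇝*-∘ ~>⇒⇝* (pred-suc n)

  Ifz-Computes : {x y : 𝓛 ℕ} (s t r : Term ι) → s Computes x → t Computes y
               → (n : ℕ) → r ⇝* numeral n → (Ifz · s · t · r) Computes χ x y n
  Ifz-Computes s t r cs ct zero    rr d =
    ⇝*-cong (Ifz · s · t ·_) (ifz-cong s t) rr ⇝*-∘ ~>⇒⇝* (ifz-zero s t) ⇝*-∘ cs d
  Ifz-Computes s t r cs ct (suc n) rr d =
    ⇝*-cong (Ifz · s · t ·_) (ifz-cong s t) rr ⇝*-∘ ~>⇒⇝* (ifz-suc s t n) ⇝*-∘ ct d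

  Fix-Adequate-iter : (σ : Ty) (f : DCPO.Carrier ⟦ σ ⇒ σ ⟧ty) (F : Term (σ ⇒ σ))
                    → Adequate (σ ⇒ σ) f F → (n : ℕ) → Adequate σ (iter ⟦ σ ⟧ty f n) (Fix · F)
  Fix-Adequate-iter σ f F a zero    = Adequate-⊥ σ (Fix · F)
  Fix-Adequate-iter σ f F a (suc n) =
    Adequate-⇝* σ (~>⇒⇝* (fix-red F)) (a (iter ⟦ σ ⟧ty f n) (Fix · F) (Fix-Adequate-iter σ f F a n))

  ⟦⟧-Adequate : {σ : Ty} (t : Term σ) → Adequate σ ⟦ t ⟧ t
  ⟦⟧-Adequate Zero             = lift λ _ → ⇝*-refl
  ⟦⟧-Adequate Succ             = λ l t a → lift λ p → ⇝*-cong (Succ ·_) succ-cong (lower a p)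
  ⟦⟧-Adequate Pred             = λ l t a → lift λ p → Pred-⇝* t (value l p) (lower a p)
  ⟦⟧-Adequate Ifz              = λ x s as y t at l r ar → lift λ (p , d) →
    Ifz-Computes s t r (lower as) (lower at) (value l p) (lower ar p) d
  ⟦⟧-Adequate (K {σ})          = λ x s as y t _ → Adequate-⇝* σ (~>⇒⇝* (k-red s t)) as
  ⟦⟧-Adequate (S {σ} {τ} {ρ})  = λ f F af g G ag x X aX →
    Adequate-⇝* ρ (~>⇒⇝* (s-red F G X)) (af x X aX (proj₁ g x) (G · X) (ag x X aX))
  ⟦⟧-Adequate (Fix {σ})        = λ f F af →
    Adequate-∐ σ (iter ⟦ σ ⟧ty f) (iter-dir ⟦ σ ⟧ty f) (Fix · F) (Fix-Adequate-iter σ f F af)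
  ⟦⟧-Adequate (s · t)          = ⟦⟧-Adequate s ⟦ t ⟧ t (⟦⟧-Adequate t)

theorem7p2 : (ax : Axioms) → let open Semantics ax in
    (t : Term ι) (p : isdefined ⟦ t ⟧) → t ⇝* numeral (value ⟦ t ⟧ p)
theorem7p2 ax t = lower (Adequacy.⟦⟧-Adequate ax t)
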